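{- Let $G$ be a connected graph. If $G$ has at least $k$ unsuspended maximal 2-sets, then $|V(\mathcal{H}(G))\setminus V(G)|\ge k$.
   Context: Graphs are finite, simple, with shortest-path metric $d$. A set $M\subseteq V(G)$ is a 2-set if $d(x,y)\le 2$ for all $x,y\in M$; it is maximal if maximal under inclusion. A vertex $v$ suspends $M$ if $v$ is adjacent to every $u\in M\setminus\{v\}$; $M$ is unsuspended if no vertex of $G$ suspends it. A graph is Helly if every family of pairwise intersecting disks $D(v,r)=\{u:d(u,v)\le r\}$ has a common vertex. The injective hull $\mathcal{H}(G)$ is the unique minimal Helly graph containing $G$ as an isometric subgraph (vertices: functions $f:V(G)\to\mathbb{Z}_{\ge0}$ with $f(x)+f(y)\ge d_G(x,y)$ for all $x,y$ and for each $x$ some $y$ with equality; adjacency: sup-norm distance 1), and $V(G)$ is identified with the vertices $d_G(z,\cdot)$, $z\in V(G)$. -}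

module Defs where

open import Data.Nat using (ℕ; zero; suc; _+_; _≤_)
open import Data.Fin using (Fin)
open import Data.Fin.Subset using (Subset; _∈_; _⊆_)
open import Data.Product using (Σ; ∃; ∃-syntax; _×_)
open import Relation.Nullary using (¬_; Dec)
open import Relation.Binary.PropositionalEquality using (_≡_; _≢_)

record Graph (n : ℕ) : Set₁ where
  field
    Adj    : Fin n → Fin n → Set
    adj?   : ∀ x y → Dec (Adj x y)
    sym    : ∀ {x y} → Adj x y → Adj y x
    irrefl : ∀ {x} → ¬ Adj x x

module _ {n : ℕ} (G : Graph n) where
  open Graph G

  data Walk : Fin n → Fin n → ℕ → Set where
    nil  : ∀ x → Walk x x 0
    cons : ∀ {x y z m} → Adj x y → Walk y z m → Walk x z (suc m)

  Dist : Fin n → Fin n → ℕ → Set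
  Dist x y m = Walk x y m × (∀ m' → Walk x y m' → m ≤ m')

  Connected : Set
  Connected = ∀ x y → ∃[ m ] Walk x y m

  TwoSet : Subset n → Set
  TwoSet M = ∀ x y → x ∈ M → y ∈ M → ∃[ m ] (Dist x y m × m ≤ 2)

  MaximalTwoSet : Subset n → Set
  MaximalTwoSet M = TwoSet M × (∀ M' → M ⊆ M' → TwoSet M' → M' ≡ M)

  Suspends : Fin n → Subset n → Set
  Suspends v M = ∀ u → u ∈ M → u ≢ v → Adj v u

  Unsuspended : Subset n → Set
  Unsuspended M = ∀ v → ¬ Suspends v M

  HullVertex : (Fin n → ℕ) → Set
  HullVertex f = (∀ x y m → Dist x y m → m ≤ f x + f y)
               × (∀ x → ∃[ y ] Dist x y (f x + f y))

  -- f is (the image of) an original vertex z, i.e. f = d(z, ·).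
  IsGraphVertex : (Fin n → ℕ) → Set
  IsGraphVertex f = ∃[ z ] (∀ y → Dist z y (f y))

module Submission where

-- The argument:
--   * every metric form dominates an extremal one, obtained by lowering the
--     values at non-tight vertices one step at a time;
--   * for a 2-set M, the form that is 1 on M and the eccentricity off M is
--     metric, so some hull vertex f is ≤ 1 on M;
--   * if M is unsuspended, such an f equals 1 on M (a zero would make its
--     vertex suspend M), and f = d(z,·) is impossible (z would suspend M);
--   * if M is maximal, every x with f x ≤ 1 lies in M, since M ∪ {x} is
--     still a 2-set; hence f determines M, and distinct sets give distinct
--     hull vertices.

open import Defs
open import Data.Nat using (ℕ; zero; suc; pred; _+_; _≤_; _<_; z≤n; s≤s)
open import Data.Nat.Properties
  using (≤-refl; ≤-reflexive; ≤-trans; ≤-antisym; ≤-pred; ≮⇒≥; n≤0⇒n≡0;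
         n≢0⇒n>0; m≤n⇒m<n∨m≡n; pred[n]≤n; m≤m+n; m≤n+m; +-comm; +-mono-≤; +-monoʳ-≤;
         module ≤-Reasoning)
open import Data.Nat using () renaming (_≟_ to _≟ℕ_)
open import Data.Fin using (Fin; _≟_)
open import Data.Fin.Properties using (any?)
open import Data.Fin.Subset using (Subset; _∈_; _⊆_; _∪_; ⁅_⁆)
open import Data.Fin.Subset.Properties using (_∈?_; x∈⁅x⁆; x∈⁅y⁆⇒x≡y; x∈p∪q⁻; x∈p∪q⁺)
open import Data.Product using (Σ; ∃-syntax; _×_; _,_; proj₁; proj₂)
open import Data.Sum using (_⊎_; inj₁; inj₂)
open import Data.Empty using (⊥-elim)
open import Data.List using (List; []; _∷_; map; allFin)
open import Data.List.Extrema.Nat using (max; v≤max⁺)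
open import Data.List.Relation.Unary.Any using (here; there) renaming (map to any-map)
open import Data.List.Relation.Unary.Any.Properties using (map⁺)
open import Data.List.Membership.Propositional using () renaming (_∈_ to _∈ᴸ_)
open import Data.List.Membership.Propositional.Properties using (∈-allFin)
open import Data.Vec.Functional using (updateAt)
open import Data.Vec.Functional.Properties using (updateAt-updates; updateAt-minimal)
open import Relation.Nullary using (¬_; Dec; yes; no)
open import Relation.Nullary.Decidable using (_×-dec_)
open import Relation.Unary using (Decidable)
open import Relation.Binary.PropositionalEquality

search : ∀ {P : ℕ → Set} → Decidable P → ∀ b
       → (Σ ℕ λ m → P m × (∀ m' → P m' → m ≤ m')) ⊎ (∀ m → m ≤ b → ¬ P m)
search P? zero with P? 0
... | yes P0 = inj₁ (0 , P0 , λ _ _ → z≤n)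
... | no ¬P0 = inj₂ λ { _ z≤n → ¬P0 }
search {P} P? (suc b) with search P? b
... | inj₁ found = inj₁ found
... | inj₂ none with P? (suc b)
...   | yes Psb = inj₁ (suc b , Psb , λ m' Pm' → ≮⇒≥ λ m'<sb → none m' (≤-pred m'<sb) Pm')
...   | no ¬Psb = inj₂ fails
  where
  fails : ∀ m → m ≤ suc b → ¬ P m
  fails m m≤sb with m≤n⇒m<n∨m≡n m≤sb
  ... | inj₁ m<sb = none m (≤-pred m<sb)
  ... | inj₂ refl = ¬Psb

least : ∀ {P : ℕ → Set} → Decidable P → ∀ {b} → P b
      → Σ ℕ λ m → P m × (∀ m' → P m' → m ≤ m')
least P? {b} Pb with search P? b
... | inj₁ found = found
... | inj₂ none = ⊥-elim (none b ≤-refl Pb)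

maxOver : ∀ {n} → (Fin n → ℕ) → ℕ
maxOver {n} f = max 0 (map f (allFin n))

≤-maxOver : ∀ {n} (f : Fin n → ℕ) i → f i ≤ maxOver f
≤-maxOver {n} f i = v≤max⁺ 0 (map f (allFin n))
  (inj₂ (map⁺ (any-map (λ { refl → ≤-refl }) (∈-allFin i))))

module Walks {n : ℕ} (G : Graph n) where
  open Graph G renaming (sym to adj-sym)

  walk? : ∀ m x y → Dec (Walk G x y m)
  walk? zero x y with x ≟ y
  ... | yes refl = yes (nil x)
  ... | no x≢y = no λ { (nil _) → x≢y refl }
  walk? (suc m) x y with any? (λ w → adj? x w ×-dec walk? m w y)
  ... | yes (w , x~w , w⇝y) = yes (cons x~w w⇝y)
  ... | no ¬step = no λ { (cons {y = w} x~w w⇝y) → ¬step (w , x~w , w⇝y) }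

  append : ∀ {x y z m k} → Walk G x y m → Walk G y z k → Walk G x z (m + k)
  append (nil _) q = q
  append (cons a p) q = cons a (append p q)

  reverse : ∀ {x y m} → Walk G x y m → Walk G y x m
  reverse (nil x) = nil x
  reverse (cons {m = m} a p) =
    subst (Walk G _ _) (+-comm m 1) (append (reverse p) (cons (adj-sym a) (nil _)))

  short-walk-adj : ∀ {x y m} → x ≢ y → m ≤ 1 → Walk G x y m → Adj x y
  short-walk-adj x≢y _ (nil _) = ⊥-elim (x≢y refl)
  short-walk-adj _ _ (cons a (nil _)) = a
  short-walk-adj _ (s≤s ()) (cons _ (cons _ _))

module GraphMetric {n : ℕ} (G : Graph n) (conn : Connected G) where
  open Graph G using (Adj)
  open Walks G

  distance : ∀ x y → Σ ℕ (Dist G x y)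
  distance x y = least (λ m → walk? m x y) (proj₂ (conn x y))

  d : Fin n → Fin n → ℕ
  d x y = proj₁ (distance x y)

  d-dist : ∀ x y → Dist G x y (d x y)
  d-dist x y = proj₂ (distance x y)

  dist-unique : ∀ {x y m} → Dist G x y m → d x y ≡ m
  dist-unique {x} {y} (p , minimal) =
    ≤-antisym (proj₂ (d-dist x y) _ p) (minimal _ (proj₁ (d-dist x y)))

  d-refl : ∀ x → d x x ≡ 0
  d-refl x = n≤0⇒n≡0 (proj₂ (d-dist x x) 0 (nil x))

  d-sym : ∀ x y → d x y ≡ d y x
  d-sym x y = ≤-antisym (proj₂ (d-dist x y) _ (reverse (proj₁ (d-dist y x))))
                        (proj₂ (d-dist y x) _ (reverse (proj₁ (d-dist x y))))

  d≤1⇒adj : ∀ {x y} → x ≢ y → d x y ≤ 1 → Adj x y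
  d≤1⇒adj {x} {y} x≢y le = short-walk-adj x≢y le (proj₁ (d-dist x y))

  suspends-within-1 : ∀ {v M} → (∀ u → u ∈ M → u ≢ v → d v u ≤ 1) → Suspends G v M
  suspends-within-1 close u u∈M u≢v = d≤1⇒adj (λ v≡u → u≢v (sym v≡u)) (close u u∈M u≢v)

module MetricForms {n : ℕ} (G : Graph n) (conn : Connected G) where
  open GraphMetric G conn

  MetricForm : (Fin n → ℕ) → Set
  MetricForm f = ∀ x y → d x y ≤ f x + f y

  TightAt : (Fin n → ℕ) → Fin n → Set
  TightAt f x = ∃[ y ] d x y ≡ f x + f y

  Extremal : (Fin n → ℕ) → Set
  Extremal f = ∀ x → TightAt f x

  _≤ᶠ_ : (Fin n → ℕ) → (Fin n → ℕ) → Set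
  f ≤ᶠ g = ∀ z → f z ≤ g z

  extremal-hull-vertex : ∀ {f} → MetricForm f → Extremal f → HullVertex G f
  extremal-hull-vertex {f} metric extremal =
      (λ x y m dist → subst (_≤ f x + f y) (dist-unique dist) (metric x y))
    , λ x → proj₁ (extremal x)
          , subst (Dist G x (proj₁ (extremal x))) (proj₂ (extremal x)) (d-dist x _)

  -- If x is not tight in a metric form f with f x = 1 + v, lowering f x to v
  -- keeps the form metric: every inequality at x was strict.
  lowering-keeps-metric : ∀ {f x v} → MetricForm f → f x ≡ suc v → ¬ TightAt f x
                        → MetricForm (updateAt f x pred)
  lowering-keeps-metric {f} {x} {v} metric fx≡sv loose = lowered
    where
    f′ = updateAt f x pred

    f′x≡v : f′ x ≡ v
    f′x≡v = trans (updateAt-updates x f) (cong pred fx≡sv)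

    f′-off : ∀ z → z ≢ x → f′ z ≡ f z
    f′-off z z≢x = updateAt-minimal z x f z≢x

    near : ∀ y → d x y ≤ v + f y
    near y with m≤n⇒m<n∨m≡n (metric x y)
    ... | inj₁ lt = ≤-pred (subst (λ t → d x y < t + f y) fx≡sv lt)
    ... | inj₂ eq = ⊥-elim (loose (y , eq))

    from-x : ∀ y → y ≢ x → d x y ≤ f′ x + f′ y
    from-x y y≢x rewrite f′x≡v | f′-off y y≢x = near y

    lowered : MetricForm f′
    lowered a b with a ≟ x | b ≟ x
    ... | yes refl | yes refl = subst (_≤ f′ a + f′ a) (sym (d-refl a)) z≤n
    ... | yes refl | no b≢x = from-x b b≢x
    ... | no a≢x | yes refl =
      subst₂ _≤_ (d-sym b a) (+-comm (f′ b) (f′ a)) (from-x a a≢x)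
    ... | no a≢x | no b≢x rewrite f′-off a a≢x | f′-off b b≢x = metric a b

  record Lowering (f : Fin n → ℕ) (x : Fin n) : Set where
    field
      form   : Fin n → ℕ
      metric : MetricForm form
      below  : form ≤ᶠ f
      fixes  : ∀ z → z ≢ x → form z ≡ f z
      tight  : TightAt form x

  -- Lower f at x until x becomes tight; this happens at the latest when
  -- f x = 0, since d x x = 0.  Induction on the value f x.
  tighten-at : ∀ f x → MetricForm f → Lowering f x
  tighten-at f x = go (f x) f refl
    where
    go : ∀ v f → f x ≡ v → MetricForm f → Lowering f x
    go v f fx≡v metric with any? (λ y → d x y ≟ℕ f x + f y)
    ... | yes tight = record { form = f ; metric = metric ; below = λ _ → ≤-refl
                             ; fixes = λ _ _ → refl ; tight = tight }
    go zero f fx≡0 metric | no loose =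
      ⊥-elim (loose (x , trans (d-refl x) (sym (cong₂ _+_ fx≡0 fx≡0))))
    go (suc v) f fx≡sv metric | no loose = record
      { form = form
      ; metric = metric′
      ; below = λ z → ≤-trans (below z) (lowered-below z)
      ; fixes = λ z z≢x → trans (fixes z z≢x) (updateAt-minimal z x f z≢x)
      ; tight = tight }
      where
      lowered-below : updateAt f x pred ≤ᶠ f
      lowered-below z with z ≟ x
      ... | yes refl = subst (_≤ f z) (sym (updateAt-updates z f)) pred[n]≤n
      ... | no z≢x = ≤-reflexive (updateAt-minimal z x f z≢x)

      open Lowering (go v (updateAt f x pred)
                        (trans (updateAt-updates x f) (cong pred fx≡sv))
                        (lowering-keeps-metric metric fx≡sv loose))
        renaming (metric to metric′)

  -- Tightness at w survives lowering a metric form elsewhere, because the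
  -- lower form is squeezed between d w y and the old tight value.
  tight-persists : ∀ {f f′ w} → MetricForm f′ → f′ ≤ᶠ f → f′ w ≡ f w
                 → TightAt f w → TightAt f′ w
  tight-persists {f} {f′} {w} metric′ below same (y , tight) = y , ≤-antisym (metric′ w y) squeeze
    where
    open ≤-Reasoning
    squeeze : f′ w + f′ y ≤ d w y
    squeeze = begin
      f′ w + f′ y ≤⟨ +-monoʳ-≤ (f′ w) (below y) ⟩
      f′ w + f y  ≡⟨ cong (_+ f y) same ⟩
      f w + f y   ≡⟨ sym tight ⟩
      d w y       ∎

  tighten-all : ∀ (L : List (Fin n)) f → MetricForm f
              → Σ (Fin n → ℕ) λ f′ → MetricForm f′ × f′ ≤ᶠ f × (∀ w → w ∈ᴸ L → TightAt f′ w)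
  tighten-all [] f metric = f , metric , (λ _ → ≤-refl) , λ _ ()
  tighten-all (x ∷ L) f metric with tighten-all L f metric
  ... | f₁ , metric₁ , f₁≤f , tight₁ =
    form , lowered.metric , (λ z → ≤-trans (below z) (f₁≤f z)) , tight-on
    where
    module lowered = Lowering (tighten-at f₁ x metric₁)
    open lowered using (form; below; fixes; tight)

    tight-on : ∀ w → w ∈ᴸ x ∷ L → TightAt form w
    tight-on w (here refl) = tight
    tight-on w (there w∈L) with w ≟ x
    ... | yes refl = tight
    ... | no w≢x = tight-persists lowered.metric below (fixes w w≢x) (tight₁ w w∈L)

  extremal-below : ∀ f → MetricForm f → Σ (Fin n → ℕ) λ f′ → MetricForm f′ × f′ ≤ᶠ f × Extremal f′
  extremal-below f metric with tighten-all (allFin n) f metric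
  ... | f′ , metric′ , below , tight = f′ , metric′ , below , λ w → tight w (∈-allFin w)

module TwoSets {n : ℕ} (G : Graph n) (conn : Connected G) where
  open GraphMetric G conn
  open MetricForms G conn

  two-set-bound : ∀ {M x y} → TwoSet G M → x ∈ M → y ∈ M → d x y ≤ 2
  two-set-bound {x = x} {y} twoSet x∈M y∈M with twoSet x y x∈M y∈M
  ... | m , dist , m≤2 = subst (_≤ 2) (sym (dist-unique dist)) m≤2

  maximal-closed : ∀ {A x} → MaximalTwoSet G A → (∀ y → y ∈ A → d x y ≤ 2) → x ∈ A
  maximal-closed {A} {x} (twoSet , maximal) near =
    subst (x ∈_) (maximal (A ∪ ⁅ x ⁆) (λ y∈A → x∈p∪q⁺ (inj₁ y∈A)) extended)
          (x∈p∪q⁺ (inj₂ (x∈⁅x⁆ x)))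
    where
    member : ∀ {y} → y ∈ A ∪ ⁅ x ⁆ → y ∈ A ⊎ y ≡ x
    member y∈ with x∈p∪q⁻ A ⁅ x ⁆ y∈
    ... | inj₁ y∈A = inj₁ y∈A
    ... | inj₂ y∈x = inj₂ (x∈⁅y⁆⇒x≡y _ y∈x)

    bounded : ∀ {a b} → a ∈ A ⊎ a ≡ x → b ∈ A ⊎ b ≡ x → d a b ≤ 2
    bounded (inj₁ a∈A) (inj₁ b∈A) = two-set-bound twoSet a∈A b∈A
    bounded (inj₂ refl) (inj₁ b∈A) = near _ b∈A
    bounded {a} {b} (inj₁ a∈A) (inj₂ refl) = subst (_≤ 2) (d-sym b a) (near a a∈A)
    bounded {a} (inj₂ refl) (inj₂ refl) = subst (_≤ 2) (sym (d-refl a)) z≤n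

    extended : TwoSet G (A ∪ ⁅ x ⁆)
    extended a b a∈ b∈ = d a b , d-dist a b , bounded (member a∈) (member b∈)

  member-if-≤1 : ∀ {A f x} → MaximalTwoSet G A → MetricForm f
               → (∀ y → y ∈ A → f y ≤ 1) → f x ≤ 1 → x ∈ A
  member-if-≤1 {f = f} {x} maximal metric ≤1-on fx≤1 =
    maximal-closed maximal λ y y∈A → ≤-trans (metric x y) (+-mono-≤ fx≤1 (≤1-on y y∈A))

  -- A metric form ≤ 1 on an unsuspended set M is exactly 1 on M: a zero at
  -- x ∈ M would put every other member of M at distance ≤ 1 from x.
  unsuspended-forces-one : ∀ {M f} → Unsuspended G M → MetricForm f
                         → (∀ x → x ∈ M → f x ≤ 1) → ∀ x → x ∈ M → f x ≡ 1
  unsuspended-forces-one {M} {f} unsuspended metric ≤1-on x x∈M =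
    ≤-antisym (≤1-on x x∈M) (n≢0⇒n>0 λ fx≡0 → unsuspended x (suspends-within-1 λ u u∈M _ →
      ≤-trans (metric x u) (subst (_≤ 1) (cong (_+ f u) (sym fx≡0)) (≤1-on u u∈M))))

  -- A form equal to 1 on an unsuspended set is not of the form d(z,·),
  -- since then z would suspend the set.
  not-graph-vertex : ∀ {M f} → Unsuspended G M → (∀ x → x ∈ M → f x ≡ 1)
                   → ¬ IsGraphVertex G f
  not-graph-vertex unsuspended one-on (z , dist) = unsuspended z (suspends-within-1 λ u u∈M _ →
    ≤-reflexive (trans (dist-unique (dist u)) (one-on u u∈M)))

  eccentricity : Fin n → ℕ
  eccentricity x = maxOver (d x)

  indicator : Subset n → Fin n → ℕ
  indicator M x with x ∈? M
  ... | yes _ = 1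
  ... | no _ = eccentricity x

  indicator-member : ∀ {M x} → x ∈ M → indicator M x ≡ 1
  indicator-member {M} {x} x∈M with x ∈? M
  ... | yes _ = refl
  ... | no x∉M = ⊥-elim (x∉M x∈M)

  indicator-metric : ∀ {M} → TwoSet G M → MetricForm (indicator M)
  indicator-metric {M} twoSet x y with x ∈? M | y ∈? M
  ... | yes x∈M | yes y∈M = two-set-bound twoSet x∈M y∈M
  ... | no _ | _ = ≤-trans (≤-maxOver (d x) y) (m≤m+n _ _)
  ... | yes _ | no _ = ≤-trans (≤-reflexive (d-sym x y)) (≤-trans (≤-maxOver (d y) x) (m≤n+m _ _))

  record HullPoint (M : Subset n) : Set where
    field
      form     : Fin n → ℕ
      metric   : MetricForm form
      extremal : Extremal form
      ≤1-on    : ∀ x → x ∈ M → form x ≤ 1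

  hull-point : ∀ {M} → TwoSet G M → HullPoint M
  hull-point {M} twoSet with extremal-below (indicator M) (indicator-metric twoSet)
  ... | f , metric , below , extremal = record
    { form = f ; metric = metric ; extremal = extremal
    ; ≤1-on = λ x x∈M → subst (f x ≤_) (indicator-member x∈M) (below x) }

lemma18 : ∀ {n : ℕ} (G : Graph n) → Connected G → (k : ℕ)
    → (Ms : Fin k → Subset n)
    → (∀ i j → Ms i ≡ Ms j → i ≡ j)
    → (∀ i → MaximalTwoSet G (Ms i) × Unsuspended G (Ms i))
    → Σ (Fin k → (Fin n → ℕ)) λ h →
    (∀ i → HullVertex G (h i) × ¬ IsGraphVertex G (h i))
    × (∀ i j → (∀ x → h i x ≡ h j x) → i ≡ j)
lemma18 G conn k Ms distinct hyp = h , (λ i → hull-vertex i , not-graph-vertex (unsuspended i) (one i)) , injective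
  where
  open MetricForms G conn using (extremal-hull-vertex)
  open TwoSets G conn
  open HullPoint

  maximal : ∀ i → MaximalTwoSet G (Ms i)
  maximal i = proj₁ (hyp i)

  unsuspended : ∀ i → Unsuspended G (Ms i)
  unsuspended i = proj₂ (hyp i)

  V : ∀ i → HullPoint (Ms i)
  V i = hull-point (proj₁ (maximal i))

  h : Fin _ → Fin _ → ℕ
  h i = form (V i)

  hull-vertex : ∀ i → HullVertex G (h i)
  hull-vertex i = extremal-hull-vertex {h i} (metric (V i)) (extremal (V i))

  one : ∀ i x → x ∈ Ms i → h i x ≡ 1
  one i = unsuspended-forces-one (unsuspended i) (metric (V i)) (≤1-on (V i))

  -- Equal hull vertices force M_j ⊆ M_i, hence M_i = M_j by maximality.
  injective : ∀ i j → (∀ x → h i x ≡ h j x) → i ≡ j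
  injective i j same = distinct i j (proj₂ (maximal j) (Ms i) Mj⊆Mi (proj₁ (maximal i)))
    where
    Mj⊆Mi : Ms j ⊆ Ms i
    Mj⊆Mi {x} x∈Mj = member-if-≤1 (maximal i) (metric (V i)) (≤1-on (V i))
                       (≤-reflexive (trans (same x) (one j x x∈Mj)))
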